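{- Let $i\geq 1$ and $j\geq 2i+1$ be integers and $m\geq 0$. Let $G_m$ be obtained from the path $v_0v_1\ldots v_mv$ by adding $j$ flags at $v$, $i+1$ flags at $v_0$, and $i$ flags at each of $v_1,\dots,v_m$. Then $G_m$ is $(i,j)$-critical.
   Context: Multigraphs are finite without loops. A flag at a vertex $w$ is a new vertex $u$ joined to $w$ by exactly two parallel edges and incident with no other edges. A 2-fold cover of a multigraph $G$ is a pair $(L,\mathcal H)$ where $\mathcal H$ is a graph and $L$ assigns to each $v\in V(G)$ a 2-element set $L(v)=\{p(v),r(v)\}$ ($p(v)$ poor, $r(v)$ rich) such that the sets $L(v)$ partition $V(\mathcal H)$, $p(v)r(v)\in E(\mathcal H)$, edges of $\mathcal H$ between $L(u)$ and $L(v)$ ($u\ne v$) exist only if $uv\in E(G)$, and if $u,v$ are joined by $k\ge1$ edges then $\mathcal H[L(u),L(v)]$ is a union of at most $k$ perfect matchings between $L(u)$ and $L(v)$. An $\mathcal H$-map is a function $\phi$ with $\phi(v)\in L(v)$; $\mathcal H_\phi$ is the subgraph induced by $\phi(V(G))$. An $(i,j)$-coloring is an $\mathcal H$-map $\phi$ in which poor vertices of $\mathcal H_\phi$ have degree at most $i$ and rich ones degree at most $j$ in $\mathcal H_\phi$. $G$ is $(i,j)$-critical if some 2-fold cover of $G$ has no $(i,j)$-coloring while every 2-fold cover of each proper subgraph of $G$ has one. -}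

module Defs where

open import Data.Nat using (ℕ; zero; suc; _+_; _*_; _≤_; _<_; _≡ᵇ_)
open import Data.Nat.Properties using (+-comm)
open import Data.Bool using (Bool; true; false; if_then_else_)
open import Data.Fin using (Fin; toℕ; splitAt)
open import Data.Fin.Properties using (_≟_)
open import Data.Nat.ListAction using (sum)
open import Data.List using (List; []; _∷_; length; map; allFin; concat; replicate; lookup)
open import Data.List.Relation.Unary.All using (All)
open import Data.List.Relation.Unary.Any using (Any)
open import Data.Product using (Σ; _×_; _,_; ∃; ∃-syntax)
open import Data.Sum using (_⊎_; inj₁; inj₂)
open import Relation.Nullary using (¬_; does)
open import Relation.Binary.PropositionalEquality using (_≡_; _≢_; refl)
open import Function.Definitions using (Injective)

-- Finite loopless multigraphs on vertex set Fin n;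
-- μ u v = number of parallel edges joining u and v.

record Multigraph : Set where
  field
    n      : ℕ
    μ      : Fin n → Fin n → ℕ
    μ-sym  : ∀ u v → μ u v ≡ μ v u
    μ-loop : ∀ v → μ v v ≡ 0
open Multigraph public

-- V(𝓗) = Fin n × Bool; the vertex (v , false) is the
-- poor vertex p(v) and (v , true) the rich vertex r(v), so L(v) =
-- {(v,false),(v,true)} and the L(v) partition V(𝓗).  𝓗 is a simple graph
-- given by a symmetric irreflexive Boolean adjacency.
-- A perfect matching between L(u) and L(v) is a bijection σ : Bool → Bool
-- (matching (u,a) with (v,σ a)); H[L(u),L(v)] must be the union of a list
-- of at most μ u v such matchings (for μ u v = 0 this says: no edges).

Vtx : ℕ → Set
Vtx n = Fin n × Bool

record Cover (G : Multigraph) : Set where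
  field
    adj      : Vtx (n G) → Vtx (n G) → Bool
    adj-sym  : ∀ x y → adj x y ≡ adj y x
    adj-irr  : ∀ x → adj x x ≡ false
    adj-pr   : ∀ v → adj (v , false) (v , true) ≡ true
    adj-matchings : ∀ u v → u ≢ v →
      Σ (List (Bool → Bool)) λ ms →
        All (λ σ → Injective _≡_ _≡_ σ) ms ×
        length ms ≤ μ G u v ×
        (∀ a b → (adj (u , a) (v , b) ≡ true → Any (λ σ → σ a ≡ b) ms)
               × (Any (λ σ → σ a ≡ b) ms → adj (u , a) (v , b) ≡ true))
open Cover public

-- 𝓗-maps: φ v = false picks p(v), φ v = true picks r(v).
HMap : Multigraph → Set
HMap G = Fin (n G) → Bool

degφ : (G : Multigraph) → Cover G → HMap G → Fin (n G) → ℕ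
degφ G C φ v =
  sum (map (λ w → if adj C (v , φ v) (w , φ w) then 1 else 0) (allFin (n G)))

IsColoring : ℕ → ℕ → (G : Multigraph) → Cover G → HMap G → Set
IsColoring i j G C φ =
  ∀ v → degφ G C φ v ≤ (if φ v then j else i)

HasColoring : ℕ → ℕ → (G : Multigraph) → Cover G → Set
HasColoring i j G C = Σ (HMap G) λ φ → IsColoring i j G C φ

-- Subgraphs: H is (an isomorphic copy of) a subgraph of G via an injective
-- vertex map f with μ_H a b ≤ μ_G (f a) (f b).

record ProperSubgraph (G : Multigraph) : Set where
  field
    H      : Multigraph
    f      : Fin (n H) → Fin (n G)
    f-inj  : Injective _≡_ _≡_ f
    μ-le   : ∀ a b → μ H a b ≤ μ G (f a) (f b)
    proper : (∃[ v ] (∀ a → f a ≢ v)) ⊎ (∃[ a ] ∃[ b ] (μ H a b < μ G (f a) (f b)))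
open ProperSubgraph public

Critical : ℕ → ℕ → Multigraph → Set
Critical i j G =
  (Σ (Cover G) λ C → ¬ HasColoring i j G C) ×
  (∀ (S : ProperSubgraph G) (C : Cover (H S)) → HasColoring i j (H S) C)

-- Path vertices v_0,…,v_m,v are Fin (m+2): index k ≤ m is
-- v_k and index m+1 is v.  Flags: for each path vertex k we have flagCount k
-- flags hosted at k; the list `hosts` lists the host of every flag.

module _ (i j m : ℕ) where

  flagCount : Fin (suc (suc m)) → ℕ
  flagCount k with toℕ k ≡ᵇ 0 | toℕ k ≡ᵇ suc m
  ... | true  | _     = suc i
  ... | false | true  = j
  ... | false | false = i

  hosts : List (Fin (suc (suc m)))
  hosts = concat (map (λ k → replicate (flagCount k) k) (allFin (suc (suc m))))

  nG : ℕ
  nG = suc (suc m) + length hosts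

  -- one-directional edge counts: v_k → v_{k+1} (1 edge), flag → host (2 edges)
  dir : Fin (suc (suc m)) ⊎ Fin (length hosts) → Fin (suc (suc m)) ⊎ Fin (length hosts) → ℕ
  dir (inj₁ k) (inj₁ l) = if toℕ l ≡ᵇ suc (toℕ k) then 1 else 0
  dir (inj₂ q) (inj₁ k) = if does (lookup hosts q ≟ k) then 2 else 0
  dir _ _ = 0

  μG : Fin nG → Fin nG → ℕ
  μG x y = dir (splitAt (suc (suc m)) x) (splitAt (suc (suc m)) y)
         + dir (splitAt (suc (suc m)) y) (splitAt (suc (suc m)) x)

  private
    ≡ᵇ-suc : ∀ a → (a ≡ᵇ suc a) ≡ false
    ≡ᵇ-suc zero = refl
    ≡ᵇ-suc (suc a) = ≡ᵇ-suc a

    dir-loop : ∀ z → dir z z ≡ 0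
    dir-loop (inj₁ k) with toℕ k ≡ᵇ suc (toℕ k) | ≡ᵇ-suc (toℕ k)
    ... | false | _ = refl
    dir-loop (inj₂ q) = refl

  μG-loop : ∀ v → μG v v ≡ 0
  μG-loop v with dir (splitAt (suc (suc m)) v) (splitAt (suc (suc m)) v) | dir-loop (splitAt (suc (suc m)) v)
  ... | .0 | refl = refl

  G : Multigraph
  G = record
    { n = nG
    ; μ = μG
    ; μ-sym = λ u v → +-comm (dir (splitAt (suc (suc m)) u) (splitAt (suc (suc m)) v)) _
    ; μ-loop = μG-loop
    }

module Submission where

-- In the bad cover every flag is joined to its host by both
-- matchings, so a path vertex always gets one unit of degree per flag; the
-- edge v_m v is straight and all other path edges are crossed.  Then v must
-- be rich, v_m poor, and poverty propagates down the path to v_0, whose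
-- i + 1 flags give it degree i + 1.
--
-- A cover of a proper subgraph H is lifted to an adjacency on
-- the doubled vertex set of G_m (Transfer) that still uses at most μ x y
-- matchings on every pair (CoveredBy), and uses fewer on some pair, because
-- H misses a vertex or an edge (Deficient).  In G_m such a pair is an empty
-- path edge or a flag edge with one matching (Defect) at some height h.  The
-- colouring (Colouring) makes the path greedy from v down to P h, each vertex
-- avoiding the one above it, makes everything below h rich, and lets every
-- flag avoid its host; the degree bounds of Bounds then give an
-- (i,j)-colouring, which restricts to H because degrees only drop along the
-- embedding (deg-transfer).

open import Defs
open import Data.Nat.Properties
  using (+-0-commutativeMonoid; module ≤-Reasoning; ≡ᵇ⇒≡; 1+n≢n; 0≢1+n; m+1+n≢n; 1+n≰n; <⇒≱;
         n≤1+n; suc-injective; ≤-pred; ≤-refl; ≤-reflexive; ≤-trans; m≤m+n; m≤n+m;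
         m≤n⇒m<n∨m≡n; ≤∧≢⇒<; ≰⇒>; +-comm; +-suc; +-assoc; +-identityʳ; +-mono-≤; +-monoˡ-≤;
         +-monoʳ-≤; +-mono-<-≤; +-mono-≤-<; m∸[m∸n]≡n; +-∸-assoc; n∸n≡0)
open import Algebra.Properties.CommutativeMonoid.Sum +-0-commutativeMonoid
  using (sum-cong-≗; sum-remove; ∑-distrib-+) renaming (sum to ∑)
import Data.Nat as ℕ
open import Data.Nat using (ℕ; zero; suc; _+_; _*_; _∸_; _≤_; _<_; z≤n; s≤s; _≡ᵇ_; _≤?_)
open import Data.Nat.ListAction using (sum)
open import Data.Bool as Bool using (Bool; true; false; if_then_else_; not; _xor_; T)
open import Data.Bool.Properties using (¬-not; not-injective; not-involutive; xor-comm; xor-same)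
open import Data.Unit using (tt)
open import Data.Fin as Fin using (Fin; toℕ; _↑ˡ_; _↑ʳ_; punchOut; splitAt; join)
open import Data.Fin.Properties
  using (_≟_; any?; punchOut-injective; punchIn-punchOut; toℕ-injective; toℕ-↑ˡ; toℕ<n;
         toℕ-inject₁; splitAt-↑ˡ; splitAt-↑ʳ; join-splitAt)
  renaming (suc-injective to Fin-suc-injective)
open import Data.List using (List; []; _∷_; _++_; length; tabulate; map; allFin; lookup; replicate; concat)
open import Data.List.Properties using (map-tabulate; length-map; length-++)
open import Data.List.Relation.Unary.All as All using (All; []; _∷_)
import Data.List.Relation.Unary.All.Properties as Allₚ
open import Data.List.Relation.Unary.Any as Any using (Any; here; there)
import Data.List.Relation.Unary.Any.Properties as Anyₚ
open import Data.Product using (Σ; _×_; _,_; proj₁; proj₂)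
open import Data.Sum using (_⊎_; inj₁; inj₂; [_,_]′)
open import Data.Vec.Functional using (removeAt)
open import Data.Empty using (⊥; ⊥-elim)
open import Relation.Nullary using (¬_; does; Dec; yes; no)
open import Relation.Nullary.Decidable using (dec-true; dec-false; does-⇔)
open import Relation.Binary.PropositionalEquality
open import Function using (_∘_; id; mk⇔; case_of_)
open import Function.Definitions using (Injective)

sum-allFin : ∀ {n} (g : Fin n → ℕ) → sum (map g (allFin n)) ≡ ∑ g
sum-allFin {n} g = trans (cong sum (map-tabulate id g)) (sum-tabulate g)
  where
  sum-tabulate : ∀ {k} (h : Fin k → ℕ) → sum (tabulate h) ≡ ∑ h
  sum-tabulate {zero}  h = refl
  sum-tabulate {suc k} h = cong (h Fin.zero +_) (sum-tabulate (h ∘ Fin.suc))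

∑-mono : ∀ {n} {g h : Fin n → ℕ} → (∀ l → g l ≤ h l) → ∑ g ≤ ∑ h
∑-mono {zero}  _   = z≤n
∑-mono {suc n} g≤h = +-mono-≤ (g≤h Fin.zero) (∑-mono (g≤h ∘ Fin.suc))

∑-split : ∀ a {b} (h : Fin (a + b) → ℕ) →
          ∑ h ≡ ∑ (λ l → h (l ↑ˡ b)) + ∑ (λ l → h (a ↑ʳ l))
∑-split zero    h = refl
∑-split (suc a) h = trans (cong (h Fin.zero +_) (∑-split a (h ∘ Fin.suc)))
                          (sym (+-assoc (h Fin.zero) _ _))

∑-point : ∀ {n} (h : Fin n → ℕ) l → h l ≤ ∑ h
∑-point h Fin.zero    = m≤m+n _ _
∑-point h (Fin.suc l) = ≤-trans (∑-point (h ∘ Fin.suc) l) (m≤n+m _ _)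

spot : ∀ {n} → Fin n → ℕ → Fin n → ℕ
spot k c l = if does (l ≟ k) then c else 0

spot-hit : ∀ {n} {k l : Fin n} c → l ≡ k → spot k c l ≡ c
spot-hit {k = k} {l} c l≡k rewrite dec-true (l ≟ k) l≡k = refl

∑-spot : ∀ {n} (k : Fin n) c → ∑ (spot k c) ≡ c
∑-spot {suc n} Fin.zero    c = trans (cong (c +_) (∑-zero n)) (+-identityʳ c)
  where
  ∑-zero : ∀ n → ∑ {n} (λ _ → 0) ≡ 0
  ∑-zero zero    = refl
  ∑-zero (suc n) = ∑-zero n
∑-spot {suc n} (Fin.suc k) c = ∑-spot k c

∑-strict : ∀ {n} {g h : Fin n → ℕ} l₀ → (∀ l → g l ≤ h l) → g l₀ < h l₀ → ∑ g < ∑ h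
∑-strict Fin.zero     g≤h lt = +-mono-<-≤ lt (∑-mono (g≤h ∘ Fin.suc))
∑-strict (Fin.suc l₀) g≤h lt = +-mono-≤-< (g≤h Fin.zero) (∑-strict l₀ (g≤h ∘ Fin.suc) lt)

∑-injective : ∀ {n N} (f : Fin n → Fin N) → Injective _≡_ _≡_ f →
              (g : Fin N → ℕ) → ∑ (g ∘ f) ≤ ∑ g
∑-injective {zero}          f f-inj g = z≤n
∑-injective {suc n} {zero}  f f-inj g with () ← f Fin.zero
∑-injective {suc n} {suc N} f f-inj g = begin
  g (f Fin.zero) + ∑ (g ∘ f ∘ Fin.suc)
    ≡⟨ cong (g (f Fin.zero) +_) (sum-cong-≗ (λ a → cong g (sym (punchIn-punchOut (apart a))))) ⟩
  g (f Fin.zero) + ∑ (removeAt g (f Fin.zero) ∘ f′)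
    ≤⟨ +-monoʳ-≤ _ (∑-injective f′ f′-inj (removeAt g (f Fin.zero))) ⟩
  g (f Fin.zero) + ∑ (removeAt g (f Fin.zero))
    ≡⟨ sym (sum-remove g) ⟩
  ∑ g ∎
  where
  open ≤-Reasoning
  apart : ∀ a → f Fin.zero ≢ f (Fin.suc a)
  apart a e with () ← f-inj e
  f′ : Fin n → Fin N
  f′ a = punchOut (apart a)
  f′-inj : Injective _≡_ _≡_ f′
  f′-inj {a} {b} e = Fin-suc-injective (f-inj (punchOut-injective (apart a) (apart b) e))

ind : Bool → ℕ
ind b = if b then 1 else 0

ind≤1 : ∀ b → ind b ≤ 1
ind≤1 true  = ≤-refl
ind≤1 false = z≤n

occurrences : ∀ {n} (xs : List (Fin n)) → Fin n → ℕ
occurrences xs k = ∑ (λ q → ind (does (lookup xs q ≟ k)))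

occurrences-++ : ∀ {n} (xs ys : List (Fin n)) k →
                 occurrences (xs ++ ys) k ≡ occurrences xs k + occurrences ys k
occurrences-++ []       ys k = refl
occurrences-++ (x ∷ xs) ys k =
  trans (cong (ind (does (x ≟ k)) +_) (occurrences-++ xs ys k))
        (sym (+-assoc (ind (does (x ≟ k))) (occurrences xs k) (occurrences ys k)))

occurrences-replicate : ∀ {n} c (x k : Fin n) →
                        occurrences (replicate c x) k ≡ (if does (x ≟ k) then c else 0)
occurrences-replicate zero    x k with does (x ≟ k)
... | true  = refl
... | false = refl
occurrences-replicate (suc c) x k rewrite occurrences-replicate c x k with does (x ≟ k)
... | true  = refl
... | false = refl

occurrences-blocks : ∀ {n} (c : Fin n → ℕ) k →
  occurrences (concat (map (λ l → replicate (c l) l) (allFin n))) k ≡ c k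
occurrences-blocks {n} c k = begin
  occurrences (concat (map block (allFin n))) k
    ≡⟨ cong (λ xs → occurrences (concat xs) k) (map-tabulate id block) ⟩
  occurrences (concat (tabulate block)) k
    ≡⟨ per-block block ⟩
  ∑ (λ l → occurrences (block l) k)
    ≡⟨ sum-cong-≗ (λ l → occurrences-replicate (c l) l k) ⟩
  ∑ (λ l → if does (l ≟ k) then c l else 0)
    ≡⟨ sum-cong-≗ pick ⟩
  ∑ (spot k (c k))
    ≡⟨ ∑-spot k (c k) ⟩
  c k ∎
  where
  open ≡-Reasoning
  block : Fin n → List (Fin n)
  block l = replicate (c l) l
  per-block : ∀ {a} (g : Fin a → List (Fin n)) →
              occurrences (concat (tabulate g)) k ≡ ∑ (λ l → occurrences (g l) k)
  per-block {zero}  g = refl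
  per-block {suc a} g = trans (occurrences-++ (g Fin.zero) _ k)
                              (cong (occurrences (g Fin.zero) k +_) (per-block (g ∘ Fin.suc)))
  pick : ∀ l → (if does (l ≟ k) then c l else 0) ≡ spot k (c k) l
  pick l with l ≟ k
  ... | yes refl = refl
  ... | no _     = refl

module Degrees {n : ℕ} (A : Vtx n → Vtx n → Bool) (φ : Fin n → Bool) where

  term : Fin n → Fin n → ℕ
  term x y = ind (A (x , φ x) (y , φ y))

  deg : Fin n → ℕ
  deg x = ∑ (term x)

degφ≡deg : ∀ G (C : Cover G) φ v → degφ G C φ v ≡ Degrees.deg (adj C) φ v
degφ≡deg G C φ v = sum-allFin (Degrees.term (adj C) φ v)

-- Twisted matchings: the perfect matching a ↦ e xor a between L(x) and
-- L(y) is straight (p–p, r–r) for e = false and crossed for e = true.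
xor-injective : ∀ e → Injective _≡_ _≡_ (e xor_)
xor-injective false e = e
xor-injective true  e = not-injective e

xor-swap : ∀ e a b → e xor a ≡ b → e xor b ≡ a
xor-swap false a b refl = refl
xor-swap true  a b refl = not-involutive a

module TwistedCover (G : Multigraph) (tw : Fin (n G) → Fin (n G) → List Bool)
  (tw-len : ∀ x y → length (tw x y) + length (tw y x) ≤ μ G x y) where

  twists : Fin (n G) → Fin (n G) → List Bool
  twists x y = tw x y ++ tw y x

  Linked : Fin (n G) → Fin (n G) → Bool → Bool → Set
  Linked x y a b = Any (λ e → e xor a ≡ b) (twists x y)

  linked? : ∀ x y a b → Dec (Linked x y a b)
  linked? x y a b = Any.any? (λ e → (e xor a) Bool.≟ b) (twists x y)

  twAdj : Vtx (n G) → Vtx (n G) → Bool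
  twAdj (x , a) (y , b) = if does (x ≟ y) then a xor b else does (linked? x y a b)

  linked-sym : ∀ x y a b → Linked x y a b → Linked y x b a
  linked-sym x y a b l = Any.map (λ {e} → xor-swap e a b) (Anyₚ.++-comm (tw x y) (tw y x) l)

  twAdj-apart : ∀ x y a b → x ≢ y → twAdj (x , a) (y , b) ≡ does (linked? x y a b)
  twAdj-apart x y a b x≢y rewrite dec-false (x ≟ y) x≢y = refl

  twAdj-sym : ∀ p q → twAdj p q ≡ twAdj q p
  twAdj-sym (x , a) (y , b) with x ≟ y
  ... | yes refl rewrite dec-true (x ≟ x) refl = xor-comm a b
  ... | no x≢y = trans (does-⇔ (mk⇔ (linked-sym x y a b) (linked-sym y x b a))
                                (linked? x y a b) (linked? y x b a))
                       (sym (twAdj-apart y x b a (x≢y ∘ sym)))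

  twAdj-irr : ∀ p → twAdj p p ≡ false
  twAdj-irr (x , a) rewrite dec-true (x ≟ x) refl = xor-same a

  twAdj-pr : ∀ x → twAdj (x , false) (x , true) ≡ true
  twAdj-pr x rewrite dec-true (x ≟ x) refl = refl

  twAdj-matchings : ∀ u v → u ≢ v →
    Σ (List (Bool → Bool)) λ ms →
      All (λ σ → Injective _≡_ _≡_ σ) ms × length ms ≤ μ G u v ×
      (∀ a b → (twAdj (u , a) (v , b) ≡ true → Any (λ σ → σ a ≡ b) ms)
             × (Any (λ σ → σ a ≡ b) ms → twAdj (u , a) (v , b) ≡ true))
  twAdj-matchings u v u≢v =
    map _xor_ (twists u v) ,
    Allₚ.map⁺ (All.universal xor-injective (twists u v)) ,
    ≤-trans (≤-reflexive (trans (length-map _xor_ (twists u v)) (length-++ (tw u v)))) (tw-len u v) ,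
    λ a b → (λ e → Anyₚ.map⁺ (toWitness′ (trans (sym (twAdj-apart u v a b u≢v)) e))) ,
            (λ l → trans (twAdj-apart u v a b u≢v) (dec-true (linked? u v a b) (Anyₚ.map⁻ l)))
    where
    toWitness′ : ∀ {a b} → does (linked? u v a b) ≡ true → Linked u v a b
    toWitness′ {a} {b} e with linked? u v a b
    ... | yes l = l

  cover : Cover G
  cover = record
    { adj = twAdj ; adj-sym = twAdj-sym ; adj-irr = twAdj-irr
    ; adj-pr = twAdj-pr ; adj-matchings = twAdj-matchings }

  linked⇒adj : ∀ x y a b → x ≢ y → Linked x y a b → twAdj (x , a) (y , b) ≡ true
  linked⇒adj x y a b x≢y l = trans (twAdj-apart x y a b x≢y) (dec-true (linked? x y a b) l)

record CoveredBy {n} (c : ℕ) (A : Vtx n → Vtx n → Bool) (x y : Fin n) : Set where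
  constructor covered
  field
    matchings  : List (Bool → Bool)
    injective  : All (λ σ → Injective _≡_ _≡_ σ) matchings
    few        : length matchings ≤ c
    linked     : ∀ a b → A (x , a) (y , b) ≡ true → Any (λ σ → σ a ≡ b) matchings

cover-covered : ∀ {G} (C : Cover G) {u v} → u ≢ v → CoveredBy (μ G u v) (adj C) u v
cover-covered C {u} {v} u≢v with adj-matchings C u v u≢v
... | ms , injective , bound , linked = covered ms injective bound λ a b → proj₁ (linked a b)

covered-empty : ∀ {n c A} {x y : Fin n} → (∀ a b → A (x , a) (y , b) ≡ false) → CoveredBy c A x y
covered-empty none = covered [] [] z≤n λ a b e → case trans (sym e) (none a b) of λ ()

covered-weaken : ∀ {n c c′ A} {x y : Fin n} → c ≤ c′ → CoveredBy c A x y → CoveredBy c′ A x y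
covered-weaken c≤c′ (covered ms injective bound linked) =
  covered ms injective (≤-trans bound c≤c′) linked

covered-along : ∀ {n n′ c A B} {x y : Fin n} {u v : Fin n′} →
                (∀ a b → A (x , a) (y , b) ≡ true → B (u , a) (v , b) ≡ true) →
                CoveredBy c B u v → CoveredBy c A x y
covered-along A⊆B (covered ms injective bound linked) =
  covered ms injective bound λ a b e → linked a b (A⊆B a b e)

covered-edge : ∀ {n c A} {x y : Fin n} {a b} → CoveredBy c A x y → A (x , a) (y , b) ≡ true → 1 ≤ c
covered-edge {a = a} {b} (covered ms _ bound linked) e with linked a b e
... | any-σ = ≤-trans (nonempty any-σ) bound
  where
  nonempty : ∀ {P : (Bool → Bool) → Set} {xs} → Any P xs → 1 ≤ length xs
  nonempty (here _)  = s≤s z≤n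
  nonempty (there _) = s≤s z≤n

covered-zero : ∀ {n A} {x y : Fin n} → CoveredBy 0 A x y → ∀ a b → A (x , a) (y , b) ≡ false
covered-zero {A = A} {x} {y} cov a b with A (x , a) (y , b) in e
... | false = refl
... | true  with () ← covered-edge cov e

-- Within one matching, each vertex of L(y) has a non-neighbour in L(x):
-- `avoid` picks p(x) unless p(x) is adjacent to the given vertex of L(y).
avoid : ∀ {n} → (Vtx n → Vtx n → Bool) → Fin n → Fin n → Bool → Bool
avoid A x y b = A (x , false) (y , b)

avoid-works : ∀ {n A} {x y : Fin n} → CoveredBy 1 A x y → ∀ b → A (x , avoid A x y b) (y , b) ≡ false
avoid-works {A = A} {x} {y} (covered ms injective bound linked) b with A (x , false) (y , b) in poor
... | false = poor
... | true  with A (x , true) (y , b) in rich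
...   | false = refl
...   | true  = ⊥-elim (one-matching ms injective bound (linked false b poor) (linked true b rich))
  where
  one-matching : ∀ ms → All (λ σ → Injective _≡_ _≡_ σ) ms → length ms ≤ 1 →
                 Any (λ σ → σ false ≡ b) ms → Any (λ σ → σ true ≡ b) ms → ⊥
  one-matching (σ ∷ []) (σ-inj ∷ []) _ (here σf≡b) (here σt≡b)
    with () ← σ-inj (trans σf≡b (sym σt≡b))
  one-matching (σ ∷ []) _ _ (here _) (there ())
  one-matching (σ ∷ []) _ _ (there ()) _
  one-matching (_ ∷ _ ∷ _) _ (s≤s ()) _ _

record Deficient (G : Multigraph) (A : Vtx (n G) → Vtx (n G) → Bool) : Set where
  constructor deficient
  field
    {x y}   : Fin (n G)
    {c}     : ℕ
    thin    : c < μ G x y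
    forward : CoveredBy c A x y
    back    : CoveredBy c A y x

module Transfer {G : Multigraph} (S : ProperSubgraph G) (C : Cover (H S)) where

  Preimage : Fin (n G) → Set
  Preimage y = Σ (Fin (n (H S))) λ a → f S a ≡ y

  preimage : ∀ y → Dec (Preimage y)
  preimage y = any? (λ a → f S a ≟ y)

  liftPair : ∀ {x y} → Dec (Preimage x) → Dec (Preimage y) → Bool → Bool → Bool
  liftPair (yes (a , _)) (yes (b , _)) α β = adj C (a , α) (b , β)
  liftPair _             _             _ _ = false

  lifted : Vtx (n G) → Vtx (n G) → Bool
  lifted (x , α) (y , β) = if does (x ≟ y) then false else liftPair (preimage x) (preimage y) α β

  lifted-sym : ∀ p q → lifted p q ≡ lifted q p
  lifted-sym (x , α) (y , β) with x ≟ y | y ≟ x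
  ... | yes _   | yes _  = refl
  ... | yes x≡y | no y≢x = ⊥-elim (y≢x (sym x≡y))
  ... | no x≢y  | yes y≡x = ⊥-elim (x≢y (sym y≡x))
  ... | no _    | no _   = pair-sym (preimage x) (preimage y)
    where
    pair-sym : (dx : Dec (Preimage x)) (dy : Dec (Preimage y)) → liftPair dx dy α β ≡ liftPair dy dx β α
    pair-sym (yes (a , _)) (yes (b , _)) = adj-sym C (a , α) (b , β)
    pair-sym (yes _)       (no _)        = refl
    pair-sym (no _)        (yes _)       = refl
    pair-sym (no _)        (no _)        = refl

  lifted-at : ∀ {a b} α β → a ≢ b → lifted (f S a , α) (f S b , β) ≡ adj C (a , α) (b , β)
  lifted-at {a} {b} α β a≢b rewrite dec-false (f S a ≟ f S b) (a≢b ∘ f-inj S)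
    with preimage (f S a) | preimage (f S b)
  ... | yes (a′ , fa′≡fa) | yes (b′ , fb′≡fb) rewrite f-inj S fa′≡fa | f-inj S fb′≡fb = refl
  ... | no no-a           | _                 = ⊥-elim (no-a (a , refl))
  ... | yes _             | no no-b           = ⊥-elim (no-b (b , refl))

  lifted-outside : ∀ {x} → ¬ Preimage x → ∀ y α β → lifted (x , α) (y , β) ≡ false
  lifted-outside {x} outside y α β with x ≟ y | preimage x
  ... | yes _ | _             = refl
  ... | no _  | yes p         = ⊥-elim (outside p)
  ... | no _  | no _          = refl

  lifted-covered-at : ∀ {a b} → a ≢ b → CoveredBy (μ (H S) a b) lifted (f S a) (f S b)
  lifted-covered-at a≢b =
    covered-along (λ α β e → trans (sym (lifted-at α β a≢b)) e) (cover-covered C a≢b)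

  lifted-covered : ∀ x y → CoveredBy (μ G x y) lifted x y
  lifted-covered x y with x ≟ y
  ... | yes refl = covered-empty λ α β → diagonal α β
    where
    diagonal : ∀ α β → lifted (x , α) (x , β) ≡ false
    diagonal α β rewrite dec-true (x ≟ x) refl = refl
  ... | no x≢y with preimage x | preimage y
  ...   | yes (a , refl) | yes (b , refl) =
    covered-weaken (μ-le S a b) (lifted-covered-at (x≢y ∘ cong (f S)))
  ...   | no outside     | _              = covered-empty (lifted-outside outside y)
  ...   | yes _          | no outside     =
    covered-empty λ α β → trans (lifted-sym (x , α) (y , β)) (lifted-outside outside x β α)

  -- A proper subgraph misses a vertex or part of an edge; either way some
  -- pair of G is deficient for the lift, provided no vertex of G is isolated.
  deficiency : (∀ x → Σ (Fin (n G)) λ y → 1 ≤ μ G x y) → Deficient G lifted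
  deficiency neighbour with proper S
  ... | inj₁ (u , missed) =
    deficient (proj₂ (neighbour u)) (covered-empty (lifted-outside outside _))
              (covered-empty λ α β → trans (lifted-sym _ (u , β)) (lifted-outside outside _ β α))
    where
    outside : ¬ Preimage u
    outside (a , fa≡u) = missed a fa≡u
  ... | inj₂ (a , b , thin) =
    deficient thin (lifted-covered-at a≢b)
              (subst (λ c → CoveredBy c lifted (f S b) (f S a)) (μ-sym (H S) b a)
                     (lifted-covered-at (a≢b ∘ sym)))
    where
    a≢b : a ≢ b
    a≢b refl = case ≤-trans thin (≤-reflexive (μ-loop G (f S a))) of λ ()

  deg-transfer : ∀ φ a → degφ (H S) C (φ ∘ f S) a ≤ Degrees.deg lifted φ (f S a)
  deg-transfer φ a = begin
    degφ (H S) C (φ ∘ f S) a              ≡⟨ degφ≡deg (H S) C (φ ∘ f S) a ⟩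
    ∑ (λ b → ind (adj C (a , φ (f S a)) (b , φ (f S b))))
                                          ≡⟨ sum-cong-≗ same-term ⟩
    ∑ (λ b → term (f S a) (f S b))        ≤⟨ ∑-injective (f S) (f-inj S) (term (f S a)) ⟩
    deg (f S a)                           ∎
    where
    open ≤-Reasoning
    open Degrees lifted φ
    same-term : ∀ b → ind (adj C (a , φ (f S a)) (b , φ (f S b))) ≡ term (f S a) (f S b)
    same-term b with a ≟ b
    ... | yes refl rewrite adj-irr C (a , φ (f S a)) | dec-true (f S a ≟ f S a) refl = refl
    ... | no a≢b   = cong ind (sym (lifted-at _ _ a≢b))

≡ᵇ-true : ∀ {a b} → a ≡ b → (a ≡ᵇ b) ≡ true
≡ᵇ-true {a} {b} = dec-true (a ℕ.≟ b)

≡ᵇ-false : ∀ {a b} → a ≢ b → (a ≡ᵇ b) ≡ false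
≡ᵇ-false {a} {b} = dec-false (a ℕ.≟ b)

≡ᵇ-sound : ∀ {a b} → (a ≡ᵇ b) ≡ true → a ≡ b
≡ᵇ-sound {a} {b} e = ≡ᵇ⇒≡ a b (subst T (sym e) tt)

-- Saturating conversion ℕ → Fin (suc n): names the element with a given
-- value, without carrying a bound proof around.
clamp : ∀ n → ℕ → Fin (suc n)
clamp zero    t       = Fin.zero
clamp (suc n) zero    = Fin.zero
clamp (suc n) (suc t) = Fin.suc (clamp n t)

toℕ-clamp : ∀ n {t} → t ≤ n → toℕ (clamp n t) ≡ t
toℕ-clamp zero    z≤n     = refl
toℕ-clamp (suc n) z≤n     = refl
toℕ-clamp (suc n) (s≤s p) = cong suc (toℕ-clamp n p)

clamp-toℕ : ∀ n (k : Fin (suc n)) → clamp n (toℕ k) ≡ k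
clamp-toℕ zero    Fin.zero    = refl
clamp-toℕ (suc n) Fin.zero    = refl
clamp-toℕ (suc n) (Fin.suc k) = cong Fin.suc (clamp-toℕ n k)

-- The hypotheses on i and j are used only through i < j and i + 2 ≤ j.
i+2≤j : ∀ {i j} → 1 ≤ i → 2 * i + 1 ≤ j → 2 + i ≤ j
i+2≤j {i} {j} i≥1 j≥2i+1 =
  ≤-trans (s≤s (+-monoˡ-≤ i i≥1))
          (subst (_≤ j) (trans (cong (λ t → i + t + 1) (+-identityʳ i)) (+-comm (i + i) 1)) j≥2i+1)

i<j : ∀ {i j} → 1 ≤ i → 2 * i + 1 ≤ j → i < j
i<j i≥1 j≥2i+1 = ≤-trans (n≤1+n _) (i+2≤j i≥1 j≥2i+1)

-- The graph G_m.  Its vertices are the path vertices P k (k = 0, …, m+1,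
-- with P (m+1) = v) followed by the flags F q, each hosted at P (host q).
module Gₘ (i j m : ℕ) where

  N L : ℕ
  N = suc (suc m)
  L = length (hosts i j m)

  Gm : Multigraph
  Gm = G i j m

  V : ℕ
  V = n Gm

  host : Fin L → Fin N
  host = lookup (hosts i j m)

  fc : Fin N → ℕ
  fc = flagCount i j m

  P : Fin N → Fin V
  P k = k ↑ˡ L

  F : Fin L → Fin V
  F q = N ↑ʳ q

  data View : Fin V → Set where
    path : ∀ k → View (P k)
    flag : ∀ q → View (F q)

  view : ∀ x → View x
  view x = subst View (join-splitAt N L x) (view-split (splitAt N x))
    where
    view-split : ∀ s → View (join N L s)
    view-split (inj₁ k) = path k
    view-split (inj₂ q) = flag q

  P-injective : ∀ {k l} → P k ≡ P l → k ≡ l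
  P-injective {k} {l} e = toℕ-injective (trans (sym (toℕ-↑ˡ k L)) (trans (cong toℕ e) (toℕ-↑ˡ l L)))

  P≢F : ∀ k q → P k ≢ F q
  P≢F k q e with () ← trans (sym (splitAt-↑ˡ N k L)) (trans (cong (splitAt N) e) (splitAt-↑ʳ N L q))

  _⋖_ : Fin N → Fin N → Set
  k ⋖ l = toℕ l ≡ suc (toℕ k)

  ⋖-irrefl : ∀ {k l} → k ⋖ l → k ≢ l
  ⋖-irrefl k⋖l refl = 1+n≢n (sym k⋖l)

  at : ℕ → Fin N
  at = clamp (suc m)

  toℕ-at : ∀ {t} → t ≤ suc m → toℕ (at t) ≡ t
  toℕ-at = toℕ-clamp (suc m)

  ⋖-unique′ : ∀ {k k′ l} → k ⋖ l → k′ ⋖ l → k ≡ k′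
  ⋖-unique′ k⋖l k′⋖l = toℕ-injective (suc-injective (trans (sym k⋖l) k′⋖l))

  toℕ≤ : ∀ (k : Fin N) → toℕ k ≤ suc m
  toℕ≤ k = ≤-pred (toℕ<n k)

  successor : ∀ k → toℕ k ≤ m → Σ (Fin N) (k ⋖_)
  successor k k≤m = at (suc (toℕ k)) , toℕ-at (s≤s k≤m)

  path-neighbour : ∀ k → Σ (Fin N) (k ⋖_) ⊎ Σ (Fin N) (_⋖ k)
  path-neighbour Fin.zero    = inj₁ (Fin.suc Fin.zero , refl)
  path-neighbour (Fin.suc k) = inj₂ (Fin.inject₁ k , cong suc (sym (toℕ-inject₁ k)))

  μ-PP : ∀ k l → μ Gm (P k) (P l) ≡ ind (toℕ l ≡ᵇ suc (toℕ k)) + ind (toℕ k ≡ᵇ suc (toℕ l))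
  μ-PP k l rewrite splitAt-↑ˡ N k L | splitAt-↑ˡ N l L = refl

  μ-FP : ∀ q k → μ Gm (F q) (P k) ≡ ind (does (host q ≟ k)) * 2
  μ-FP q k rewrite splitAt-↑ˡ N k L | splitAt-↑ʳ N L q with does (host q ≟ k)
  ... | true  = refl
  ... | false = refl

  μ-FF : ∀ q q′ → μ Gm (F q) (F q′) ≡ 0
  μ-FF q q′ rewrite splitAt-↑ʳ N L q | splitAt-↑ʳ N L q′ = refl

  μ-path-edge : ∀ {k l} → k ⋖ l → μ Gm (P k) (P l) ≡ 1
  μ-path-edge {k} {l} k⋖l
    rewrite μ-PP k l | ≡ᵇ-true k⋖l | ≡ᵇ-false (λ e → m+1+n≢n 1 (sym (trans e (cong suc k⋖l)))) = refl

  μ-path-support : ∀ k l → 1 ≤ μ Gm (P k) (P l) → k ⋖ l ⊎ l ⋖ k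
  μ-path-support k l edge rewrite μ-PP k l
    with toℕ l ≡ᵇ suc (toℕ k) in up | toℕ k ≡ᵇ suc (toℕ l) in down
  ... | true  | _    = inj₁ (≡ᵇ-sound up)
  ... | false | true = inj₂ (≡ᵇ-sound down)

  μ-flag-edge : ∀ q → μ Gm (F q) (P (host q)) ≡ 2
  μ-flag-edge q rewrite μ-FP q (host q) | dec-true (host q ≟ host q) refl = refl

  μ-flag-support : ∀ q k → 1 ≤ μ Gm (F q) (P k) → host q ≡ k
  μ-flag-support q k edge rewrite μ-FP q k with host q ≟ k
  ... | yes e = e

  μ-flags-support : ∀ q q′ → 1 ≤ μ Gm (F q) (F q′) → ⊥
  μ-flags-support q q′ edge rewrite μ-FF q q′ with () ← edge

  has-neighbour : ∀ x → Σ (Fin V) λ y → 1 ≤ μ Gm x y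
  has-neighbour x with view x
  ... | flag q = P (host q) , ≤-trans (s≤s z≤n) (≤-reflexive (sym (μ-flag-edge q)))
  ... | path k with path-neighbour k
  ...   | inj₁ (l , k⋖l) = P l , ≤-reflexive (sym (μ-path-edge k⋖l))
  ...   | inj₂ (l , l⋖k) = P l , ≤-reflexive (sym (trans (μ-sym Gm (P k) (P l)) (μ-path-edge l⋖k)))

  hostCount : ∀ k → ∑ (λ q → ind (does (host q ≟ k))) ≡ fc k
  hostCount k = occurrences-blocks fc k

  budget : Fin N → ℕ
  budget k = if toℕ k ≡ᵇ suc m then j else i

  fc-bottom : ∀ k → toℕ k ≡ 0 → fc k ≡ suc i
  fc-bottom k k≡0 with toℕ k ≡ᵇ 0 in e | toℕ k ≡ᵇ suc m
  ... | true  | _ = refl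
  ... | false | _ with () ← trans (sym (≡ᵇ-true k≡0)) e

  fc-above : ∀ k → toℕ k ≢ 0 → fc k ≡ budget k
  fc-above k k≢0 with toℕ k ≡ᵇ 0 in e | toℕ k ≡ᵇ suc m
  ... | true  | _     = ⊥-elim (k≢0 (≡ᵇ-sound e))
  ... | false | true  = refl
  ... | false | false = refl

  budget-top : ∀ k → toℕ k ≡ suc m → budget k ≡ j
  budget-top k e rewrite ≡ᵇ-true e = refl

  budget-below : ∀ k → toℕ k ≤ m → budget k ≡ i
  budget-below k k≤m rewrite ≡ᵇ-false (λ e → 1+n≰n (subst (_≤ m) e k≤m)) = refl

  fc-inner : ∀ k → toℕ k ≢ 0 → toℕ k ≤ m → fc k ≡ i
  fc-inner k k≢0 k≤m = trans (fc-above k k≢0) (budget-below k k≤m)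

  module Parts (A : Vtx V → Vtx V → Bool) (φ : Fin V → Bool) where
    open Degrees A φ public

    pathPart flagPart : Fin N → ℕ
    pathPart k = ∑ (λ l → term (P k) (P l))
    flagPart k = ∑ (λ q → term (P k) (F q))

    deg-split : ∀ k → deg (P k) ≡ pathPart k + flagPart k
    deg-split k = ∑-split N (term (P k))

  -- The cover without an (i,j)-colouring: every flag is joined to its host
  -- by both matchings, the top edge v_m v is straight and every other path
  -- edge is crossed.  `twist` is oriented like `dir` in the definition of G_m.
  twist : Fin N ⊎ Fin L → Fin N ⊎ Fin L → List Bool
  twist (inj₁ k) (inj₁ l) = if toℕ l ≡ᵇ suc (toℕ k) then not (toℕ l ≡ᵇ suc m) ∷ [] else []
  twist (inj₂ q) (inj₁ k) = if does (host q ≟ k) then false ∷ true ∷ [] else []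
  twist _        _        = []

  length-twist : ∀ s t → length (twist s t) ≡ dir i j m s t
  length-twist (inj₁ k) (inj₁ l) with toℕ l ≡ᵇ suc (toℕ k)
  ... | true  = refl
  ... | false = refl
  length-twist (inj₂ q) (inj₁ k) with does (host q ≟ k)
  ... | true  = refl
  ... | false = refl
  length-twist (inj₁ k) (inj₂ q) = refl
  length-twist (inj₂ q) (inj₂ r) = refl

  module BadCover = TwistedCover Gm (λ x y → twist (splitAt N x) (splitAt N y))
    (λ x y → ≤-reflexive (cong₂ _+_ (length-twist (splitAt N x) (splitAt N y))
                                    (length-twist (splitAt N y) (splitAt N x))))

  flag-full : ∀ q a b → BadCover.twAdj (P (host q) , a) (F q , b) ≡ true
  flag-full q a b = BadCover.linked⇒adj (P (host q)) (F q) a b (P≢F (host q) q) linked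
    where
    both : Any (λ e → e xor a ≡ b) (false ∷ true ∷ [])
    both with a Bool.≟ b
    ... | yes a≡b = here a≡b
    ... | no  a≢b = there (here (sym (¬-not (a≢b ∘ sym))))
    linked : BadCover.Linked (P (host q)) (F q) a b
    linked rewrite splitAt-↑ˡ N (host q) L | splitAt-↑ʳ N L q
                 | dec-true (host q ≟ host q) refl = both

  path-linked : ∀ {k l} → k ⋖ l → ∀ a b → not (toℕ l ≡ᵇ suc m) xor a ≡ b →
                BadCover.twAdj (P l , a) (P k , b) ≡ true
  path-linked {k} {l} k⋖l a b e =
    BadCover.linked⇒adj (P l) (P k) a b (⋖-irrefl k⋖l ∘ P-injective ∘ sym) linked
    where
    linked : BadCover.Linked (P l) (P k) a b
    linked rewrite splitAt-↑ˡ N k L | splitAt-↑ˡ N l L | ≡ᵇ-true k⋖l =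
      Anyₚ.++⁺ʳ (twist (inj₁ l) (inj₁ k)) (here e)

  module NoColouring (i≥1 : 1 ≤ i) (j≥2i+1 : 2 * i + 1 ≤ j) (φ : Fin V → Bool)
    (bounded : ∀ x → Degrees.deg BadCover.twAdj φ x ≤ (if φ x then j else i)) where
    open Parts BadCover.twAdj φ

    top : Fin N
    top = at (suc m)

    toℕ-top : toℕ top ≡ suc m
    toℕ-top = toℕ-at ≤-refl

    poor-bound : ∀ x → φ x ≡ false → deg x ≤ i
    poor-bound x e = subst (λ c → deg x ≤ (if c then j else i)) e (bounded x)

    rich-bound : ∀ x → φ x ≡ true → deg x ≤ j
    rich-bound x e = subst (λ c → deg x ≤ (if c then j else i)) e (bounded x)

    deg-lower : ∀ k l → fc k + term (P k) (P l) ≤ deg (P k)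
    deg-lower k l = begin
      fc k + term (P k) (P l)       ≡⟨ +-comm (fc k) _ ⟩
      term (P k) (P l) + fc k       ≤⟨ +-mono-≤ (∑-point (λ l′ → term (P k) (P l′)) l) flags ⟩
      pathPart k + flagPart k       ≡⟨ sym (deg-split k) ⟩
      deg (P k)                     ∎
      where
      open ≤-Reasoning
      flag-term : ∀ q → ind (does (host q ≟ k)) ≤ term (P k) (F q)
      flag-term q with host q ≟ k
      ... | yes refl = ≤-reflexive (sym (cong ind (flag-full q (φ (P k)) (φ (F q)))))
      ... | no  _    = z≤n
      flags : fc k ≤ flagPart k
      flags = subst (_≤ flagPart k) (hostCount k) (∑-mono flag-term)

    flags≤deg : ∀ k → fc k ≤ deg (P k)
    flags≤deg k = ≤-trans (m≤m+n (fc k) _) (deg-lower k k)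

    fc-top : fc top ≡ j
    fc-top = trans (fc-above top (λ e → 0≢1+n (trans (sym e) toℕ-top))) (budget-top top toℕ-top)

    heavy : ∀ {k l} → k ⋖ l → not (toℕ l ≡ᵇ suc m) xor φ (P l) ≡ φ (P k) →
            suc (fc l) ≤ deg (P l)
    heavy {k} {l} k⋖l twisted =
      subst (_≤ deg (P l)) (trans (cong (λ b → fc l + ind b) (path-linked k⋖l _ _ twisted))
                                  (+-comm (fc l) 1))
            (deg-lower l k)

    -- v carries j > i flags, so it is rich.
    top-rich : φ (P top) ≡ true
    top-rich with φ (P top) in e
    ... | true  = refl
    ... | false = ⊥-elim (<⇒≱ (i<j i≥1 j≥2i+1) (begin
      j            ≡⟨ sym fc-top ⟩
      fc top       ≤⟨ flags≤deg top ⟩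
      deg (P top)  ≤⟨ poor-bound (P top) e ⟩
      i            ∎))
      where open ≤-Reasoning

    -- The top edge is straight: a rich v_m would give v degree j + 1.
    below-top-poor : ∀ k → k ⋖ top → φ (P k) ≡ false
    below-top-poor k k⋖top with φ (P k) in e
    ... | false = refl
    ... | true  = ⊥-elim (1+n≰n (≤-trans (subst (λ c → suc c ≤ deg (P top)) fc-top (heavy k⋖top twisted))
                                        (rich-bound (P top) top-rich)))
      where
      twisted : not (toℕ top ≡ᵇ suc m) xor φ (P top) ≡ φ (P k)
      twisted rewrite ≡ᵇ-true toℕ-top | top-rich | e = refl

    -- Inner path edges are crossed: below a poor inner vertex, a rich
    -- vertex would give it degree i + 1.
    poor-step : ∀ {k l} → k ⋖ l → toℕ l ≤ m → φ (P l) ≡ false → φ (P k) ≡ false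
    poor-step {k} {l} k⋖l l≤m l-poor with φ (P k) in e
    ... | false = refl
    ... | true  = ⊥-elim (1+n≰n (≤-trans (subst (λ c → suc c ≤ deg (P l)) (fc-inner l l≢0 l≤m)
                                                (heavy k⋖l twisted))
                                        (poor-bound (P l) l-poor)))
      where
      l≢0 : toℕ l ≢ 0
      l≢0 l≡0 = 0≢1+n (trans (sym l≡0) k⋖l)
      twisted : not (toℕ l ≡ᵇ suc m) xor φ (P l) ≡ φ (P k)
      twisted rewrite ≡ᵇ-false (λ t → 1+n≰n (subst (_≤ m) t l≤m)) | l-poor | e = refl

    poor-below : ∀ d k → toℕ k + d ≡ m → φ (P k) ≡ false
    poor-below zero    k e = below-top-poor k (trans toℕ-top (cong suc (trans (sym e) (+-identityʳ _))))
    poor-below (suc d) k e =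
      poor-step k⋖l (≤-trans (m≤m+n (toℕ l) d) (≤-reflexive l+d≡m)) (poor-below d l l+d≡m)
      where
      k≤m : toℕ k ≤ m
      k≤m = ≤-trans (m≤m+n (toℕ k) (suc d)) (≤-reflexive e)
      l : Fin N
      l = proj₁ (successor k k≤m)
      k⋖l : k ⋖ l
      k⋖l = proj₂ (successor k k≤m)
      l+d≡m : toℕ l + d ≡ m
      l+d≡m = trans (cong (_+ d) k⋖l) (trans (sym (+-suc (toℕ k) d)) e)

    -- But v_0 carries i + 1 flags.
    contradiction : ⊥
    contradiction = 1+n≰n (begin
      suc i                 ≡⟨ sym (fc-bottom Fin.zero refl) ⟩
      fc Fin.zero           ≤⟨ flags≤deg Fin.zero ⟩
      deg (P Fin.zero)      ≤⟨ poor-bound (P Fin.zero) (poor-below m Fin.zero refl) ⟩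
      i                     ∎)
      where open ≤-Reasoning

  no-colouring : 1 ≤ i → 2 * i + 1 ≤ j → ¬ HasColoring i j Gm BadCover.cover
  no-colouring i≥1 j≥2i+1 (φ , colouring) =
    NoColouring.contradiction i≥1 j≥2i+1 φ λ x →
      subst (_≤ (if φ x then j else i)) (degφ≡deg Gm BadCover.cover φ x) (colouring x)

  module Bounds (A : Vtx V → Vtx V → Bool) (A-cov : ∀ x y → CoveredBy (μ Gm x y) A x y)
                (φ : Fin V → Bool) where
    open Parts A φ public

    term-on-edge : ∀ x y {c} → (1 ≤ μ Gm x y → term x y ≤ c) → term x y ≤ c
    term-on-edge x y {c} on-edge with A (x , φ x) (y , φ y) in e
    ... | false = z≤n
    ... | true  = on-edge (covered-edge (A-cov x y) e)

    pathPart≤ : ∀ k U D → (∀ l → k ⋖ l → term (P k) (P l) ≤ U) →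
                (∀ l → l ⋖ k → term (P k) (P l) ≤ D) → pathPart k ≤ U + D
    pathPart≤ k U D up down = begin
      pathPart k                                  ≤⟨ ∑-mono bound ⟩
      ∑ (λ l → spot above U l + spot below D l)   ≡⟨ ∑-distrib-+ (spot above U) (spot below D) ⟩
      ∑ (spot above U) + ∑ (spot below D)         ≡⟨ cong₂ _+_ (∑-spot above U) (∑-spot below D) ⟩
      U + D                                       ∎
      where
      open ≤-Reasoning
      above below : Fin N
      above = at (suc (toℕ k))
      below = at (toℕ k ∸ 1)
      is-at : ∀ {l t} → toℕ l ≡ t → l ≡ at t
      is-at {l} refl = sym (clamp-toℕ (suc m) l)
      bound : ∀ l → term (P k) (P l) ≤ spot above U l + spot below D l
      bound l = term-on-edge (P k) (P l) λ edge → case μ-path-support k l edge of λ where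
        (inj₁ k⋖l) → ≤-trans (up l k⋖l)
                       (≤-trans (≤-reflexive (sym (spot-hit U (is-at k⋖l)))) (m≤m+n _ _))
        (inj₂ l⋖k) → ≤-trans (down l l⋖k)
                       (≤-trans (≤-reflexive (sym (spot-hit D (is-at (cong (_∸ 1) (sym l⋖k)))))) (m≤n+m _ _))

    flag-term≤ : ∀ k q → term (P k) (F q) ≤ ind (does (host q ≟ k))
    flag-term≤ k q = term-on-edge (P k) (F q) λ edge →
      subst (λ b → term (P k) (F q) ≤ ind b)
            (sym (dec-true (host q ≟ k) (μ-flag-support q k (subst (1 ≤_) (μ-sym Gm (P k) (F q)) edge))))
            (ind≤1 _)

    flagPart≤ : ∀ k → flagPart k ≤ fc k
    flagPart≤ k = subst (flagPart k ≤_) (hostCount k) (∑-mono (flag-term≤ k))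

    flagPart< : ∀ k q → host q ≡ k → term (P k) (F q) ≡ 0 → flagPart k < fc k
    flagPart< k q host≡k silent =
      subst (flagPart k <_) (hostCount k)
            (∑-strict q (flag-term≤ k)
                        (subst₂ _<_ (sym silent) (sym (cong ind (dec-true (host q ≟ k) host≡k))) ≤-refl))

    deg-flag : ∀ q → deg (F q) ≤ 1
    deg-flag q = ≤-trans (∑-mono bound) (≤-reflexive (∑-spot (P (host q)) 1))
      where
      bound : ∀ y → term (F q) y ≤ spot (P (host q)) 1 y
      bound y = term-on-edge (F q) y λ edge → on-edge y edge
        where
        on-edge : ∀ y → 1 ≤ μ Gm (F q) y → term (F q) y ≤ spot (P (host q)) 1 y
        on-edge y edge with view y
        ... | path k = subst (term (F q) (P k) ≤_)
                             (sym (spot-hit 1 (cong P (sym (μ-flag-support q k edge))))) (ind≤1 _)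
        ... | flag r = ⊥-elim (μ-flags-support q r edge)

    deg-inner : ∀ k → toℕ k ≤ m → deg (P k) ≤ 2 + i
    deg-inner Fin.zero _ = begin
      deg (P Fin.zero)                        ≡⟨ deg-split Fin.zero ⟩
      pathPart Fin.zero + flagPart Fin.zero   ≤⟨ +-mono-≤ (pathPart≤ Fin.zero 1 0 (λ _ _ → ind≤1 _) λ _ ())
                                                          (flagPart≤ Fin.zero) ⟩
      1 + fc Fin.zero                         ≡⟨ cong suc (fc-bottom Fin.zero refl) ⟩
      2 + i                                   ∎
      where open ≤-Reasoning
    deg-inner k@(Fin.suc _) k≤m = begin
      deg (P k)                               ≡⟨ deg-split k ⟩
      pathPart k + flagPart k                 ≤⟨ +-mono-≤ (pathPart≤ k 1 1 (λ _ _ → ind≤1 _) (λ _ _ → ind≤1 _))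
                                                          (flagPart≤ k) ⟩
      2 + fc k                                ≡⟨ cong (2 +_) (fc-inner k (λ ()) k≤m) ⟩
      2 + i                                   ∎
      where open ≤-Reasoning

    deg-quiet : ∀ k → toℕ k ≢ 0 → (∀ l → k ⋖ l → term (P k) (P l) ≤ 0) →
                (∀ l → l ⋖ k → term (P k) (P l) ≤ 0) → deg (P k) ≤ budget k
    deg-quiet k k≢0 up down = begin
      deg (P k)                 ≡⟨ deg-split k ⟩
      pathPart k + flagPart k   ≤⟨ +-mono-≤ (pathPart≤ k 0 0 up down) (flagPart≤ k) ⟩
      fc k                      ≡⟨ fc-above k k≢0 ⟩
      budget k                  ∎
      where open ≤-Reasoning

    -- With the successor silent, one silent flag makes up for the
    -- predecessor (and for the extra flag of v_0).
    deg-slack : ∀ k q → host q ≡ k → term (P k) (F q) ≡ 0 →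
                (∀ l → k ⋖ l → term (P k) (P l) ≤ 0) → deg (P k) ≤ budget k
    deg-slack Fin.zero q hosted silent up = begin
      deg (P Fin.zero)                        ≡⟨ deg-split Fin.zero ⟩
      pathPart Fin.zero + flagPart Fin.zero   ≤⟨ +-monoˡ-≤ _ (pathPart≤ Fin.zero 0 0 up λ _ ()) ⟩
      flagPart Fin.zero                       ≤⟨ ≤-pred (subst (flagPart Fin.zero <_) (fc-bottom Fin.zero refl)
                                                               (flagPart< Fin.zero q hosted silent)) ⟩
      i                                       ≡⟨ sym (budget-below Fin.zero z≤n) ⟩
      budget Fin.zero                         ∎
      where open ≤-Reasoning
    deg-slack k@(Fin.suc _) q hosted silent up = begin
      deg (P k)                 ≡⟨ deg-split k ⟩
      pathPart k + flagPart k   ≤⟨ +-monoˡ-≤ _ (pathPart≤ k 0 1 up (λ _ _ → ind≤1 _)) ⟩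
      suc (flagPart k)          ≤⟨ flagPart< k q hosted silent ⟩
      fc k                      ≡⟨ fc-above k (λ ()) ⟩
      budget k                  ∎
      where open ≤-Reasoning

  data Defect (A : Vtx V → Vtx V → Bool) : Fin N → Set where
    empty-edge : ∀ {k l} → k ⋖ l → CoveredBy 0 A (P k) (P l) → Defect A l
    thin-flag  : ∀ q → CoveredBy 1 A (F q) (P (host q)) → Defect A (host q)

  -- In G_m a deficient pair is a path edge (of multiplicity 1) or a flag
  -- edge (of multiplicity 2).
  defect : ∀ {A} → Deficient Gm A → Σ (Fin N) (Defect A)
  defect {A} (deficient {x} {y} thin forward back) = classify (view x) (view y) thin forward back
    where
    edge : ∀ {c e} → c < e → 1 ≤ e
    edge = ≤-trans (s≤s z≤n)
    fewer : ∀ {c e d} → c < e → e ≡ suc d → c ≤ d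
    fewer thin e≡ = ≤-pred (≤-trans thin (≤-reflexive e≡))
    classify : ∀ {x y c} → View x → View y → c < μ Gm x y →
               CoveredBy c A x y → CoveredBy c A y x → Σ (Fin N) (Defect A)
    classify (path k) (path l) thin fwd bwd with μ-path-support k l (edge thin)
    ... | inj₁ k⋖l = l , empty-edge k⋖l (covered-weaken (fewer thin (μ-path-edge k⋖l)) fwd)
    ... | inj₂ l⋖k = k , empty-edge l⋖k
      (covered-weaken (fewer thin (trans (μ-sym Gm (P k) (P l)) (μ-path-edge l⋖k))) bwd)
    classify (flag q) (path k) thin fwd bwd with refl ← μ-flag-support q k (edge thin) =
      host q , thin-flag q (covered-weaken (fewer thin (μ-flag-edge q)) fwd)
    classify (path k) (flag q) thin fwd bwd
      with refl ← μ-flag-support q k (subst (1 ≤_) (μ-sym Gm (P k) (F q)) (edge thin)) =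
      host q , thin-flag q (covered-weaken (fewer thin (trans (μ-sym Gm (P (host q)) (F q)) (μ-flag-edge q))) bwd)
    classify (flag q) (flag r) thin _ _ = ⊥-elim (μ-flags-support q r (edge thin))

  module Colouring (i≥1 : 1 ≤ i) (j≥2i+1 : 2 * i + 1 ≤ j)
                   (A : Vtx V → Vtx V → Bool) (A-sym : ∀ p q → A p q ≡ A q p)
                   (A-cov : ∀ x y → CoveredBy (μ Gm x y) A x y) (h : Fin N) (flaw : Defect A h) where

    dist : Fin N → ℕ
    dist k = suc m ∸ toℕ k

    greedy : ℕ → Bool
    greedy zero    = true
    greedy (suc d) = avoid A (P (at (suc m ∸ suc d))) (P (at (suc m ∸ d))) (greedy d)

    φP : Fin N → Bool
    φP k = if does (toℕ h ≤? toℕ k) then greedy (dist k) else true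

    φ : Fin V → Bool
    φ x = [ φP , (λ q → avoid A (F q) (P (host q)) (φP (host q))) ]′ (splitAt N x)

    open Bounds A A-cov φ

    φ-P : ∀ k → φ (P k) ≡ φP k
    φ-P k = cong [ φP , _ ]′ (splitAt-↑ˡ N k L)

    φ-F : ∀ q → φ (F q) ≡ avoid A (F q) (P (host q)) (φ (P (host q)))
    φ-F q = trans (cong [ φP , _ ]′ (splitAt-↑ʳ N L q))
                  (cong (avoid A (F q) (P (host q))) (sym (φ-P (host q))))

    settled : ∀ {k} → toℕ h ≤ toℕ k → φ (P k) ≡ greedy (dist k)
    settled {k} h≤k rewrite φ-P k | dec-true (toℕ h ≤? toℕ k) h≤k = refl

    unsettled : ∀ {k} → ¬ toℕ h ≤ toℕ k → φ (P k) ≡ true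
    unsettled {k} h≰k rewrite φ-P k | dec-false (toℕ h ≤? toℕ k) h≰k = refl

    at-dist : ∀ k → at (suc m ∸ dist k) ≡ k
    at-dist k = trans (cong at (m∸[m∸n]≡n (toℕ≤ k))) (clamp-toℕ (suc m) k)

    dist-⋖ : ∀ {k l} → k ⋖ l → dist k ≡ suc (dist l)
    dist-⋖ {k} {l} k⋖l rewrite k⋖l = +-∸-assoc 1 (≤-pred (subst (_≤ suc m) k⋖l (toℕ≤ l)))

    greedy-⋖ : ∀ {k l} → k ⋖ l → greedy (dist k) ≡ avoid A (P k) (P l) (greedy (dist l))
    greedy-⋖ {k} {l} k⋖l rewrite dist-⋖ k⋖l =
      cong₂ (λ u w → avoid A (P u) (P w) (greedy (dist l)))
            (trans (cong (λ d → at (suc m ∸ d)) (sym (dist-⋖ k⋖l))) (at-dist k)) (at-dist l)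

    up-silent : ∀ {k} → toℕ h ≤ toℕ k → ∀ l → k ⋖ l → term (P k) (P l) ≤ 0
    up-silent {k} h≤k l k⋖l = ≤-reflexive (cong ind (begin
      A (P k , φ (P k)) (P l , φ (P l))                        ≡⟨ cong (λ b → A (P k , b) (P l , φ (P l))) avoids ⟩
      A (P k , avoid A (P k) (P l) (φ (P l))) (P l , φ (P l))  ≡⟨ avoid-works single (φ (P l)) ⟩
      false                                                    ∎))
      where
      open ≡-Reasoning
      single : CoveredBy 1 A (P k) (P l)
      single = subst (λ c → CoveredBy c A (P k) (P l)) (μ-path-edge k⋖l) (A-cov (P k) (P l))
      h≤l : toℕ h ≤ toℕ l
      h≤l = ≤-trans h≤k (≤-trans (n≤1+n _) (≤-reflexive (sym k⋖l)))
      avoids : φ (P k) ≡ avoid A (P k) (P l) (φ (P l))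
      avoids = trans (settled h≤k) (trans (greedy-⋖ k⋖l) (cong (avoid A (P k) (P l)) (sym (settled h≤l))))

    down-silent : ∀ {k} → toℕ h < toℕ k → ∀ l → l ⋖ k → term (P k) (P l) ≤ 0
    down-silent {k} h<k l l⋖k =
      subst (_≤ 0) (cong ind (A-sym _ _)) (up-silent (≤-pred (≤-trans h<k (≤-reflexive l⋖k))) k l⋖k)

    -- At its own height a defect provides the slack that a silent
    -- predecessor provides further up.
    slack-at : ∀ {k} → Defect A k → toℕ h ≤ toℕ k → deg (P k) ≤ budget k
    slack-at (empty-edge {k₀} {k} k₀⋖k none) h≤k =
      deg-quiet k (λ k≡0 → 0≢1+n (trans (sym k≡0) k₀⋖k)) (up-silent h≤k) down
      where
      down : ∀ l → l ⋖ k → term (P k) (P l) ≤ 0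
      down l l⋖k with refl ← ⋖-unique′ l⋖k k₀⋖k =
        ≤-reflexive (cong ind (trans (A-sym _ _) (covered-zero none _ _)))
    slack-at (thin-flag q thin) h≤k = deg-slack (host q) q refl silent (up-silent h≤k)
      where
      silent : term (P (host q)) (F q) ≡ 0
      silent = cong ind (trans (A-sym _ _)
                         (trans (cong (λ b → A (F q , b) (P (host q) , φ (P (host q)))) (φ-F q))
                                (avoid-works thin (φ (P (host q))))))

    settled-bound : ∀ {k} → toℕ h ≤ toℕ k → deg (P k) ≤ budget k
    settled-bound {k} h≤k with m≤n⇒m<n∨m≡n h≤k
    ... | inj₁ h<k =
      deg-quiet k (λ k≡0 → case subst (toℕ h <_) k≡0 h<k of λ ()) (up-silent h≤k) (down-silent h<k)
    ... | inj₂ h≡k with refl ← toℕ-injective h≡k = slack-at flaw h≤k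

    i≤target : ∀ b → i ≤ (if b then j else i)
    i≤target true  = ≤-trans (n≤1+n i) (i<j i≥1 j≥2i+1)
    i≤target false = ≤-refl

    -- The budget is j only at v, which is rich.
    budget-fits : ∀ k → toℕ h ≤ toℕ k → budget k ≤ (if φ (P k) then j else i)
    budget-fits k h≤k with toℕ k ℕ.≟ suc m
    ... | yes top rewrite budget-top k top | settled h≤k | top | n∸n≡0 (suc m) = ≤-refl
    ... | no ¬top = subst (_≤ (if φ (P k) then j else i))
                          (sym (budget-below k (≤-pred (≤∧≢⇒< (toℕ≤ k) ¬top))))
                          (i≤target (φ (P k)))

    -- Below h the rich vertices have degree at most i + 2 ≤ j.
    path-bound : ∀ k → deg (P k) ≤ (if φ (P k) then j else i)
    path-bound k with toℕ h ≤? toℕ k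
    ... | yes h≤k = ≤-trans (settled-bound h≤k) (budget-fits k h≤k)
    ... | no  h≰k = subst (λ b → deg (P k) ≤ (if b then j else i)) (sym (unsettled h≰k))
      (≤-trans (deg-inner k (≤-pred (≤-trans (≰⇒> h≰k) (toℕ≤ h)))) (i+2≤j i≥1 j≥2i+1))

    bounded : ∀ x → deg x ≤ (if φ x then j else i)
    bounded x with view x
    ... | path k = path-bound k
    ... | flag q = ≤-trans (deg-flag q) (≤-trans i≥1 (i≤target _))

proposition10p6 : (i j m : ℕ) → 1 ≤ i → 2 * i + 1 ≤ j → Critical i j (G i j m)
proposition10p6 i j m i≥1 j≥2i+1 = (BadCover.cover , no-colouring i≥1 j≥2i+1) , subgraph-colourable
  where
  open Gₘ i j m

  subgraph-colourable : ∀ S C → HasColoring i j (H S) C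
  subgraph-colourable S C = φ ∘ f S , λ a → ≤-trans (deg-transfer φ a) (bounded (f S a))
    where
    open Transfer S C
    flaw : Σ (Fin N) (Defect lifted)
    flaw = defect (deficiency has-neighbour)
    open Colouring i≥1 j≥2i+1 lifted lifted-sym lifted-covered (proj₁ flaw) (proj₂ flaw)
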